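{- Let $\mathbf{ILX}$ be a logic extending $\mathbf{IL}$, $\Gamma,\Delta$ $\mathbf{ILX}$-MCSs and $S$ a set of formulas. Then: (1) if $\Gamma\prec_S\Delta$ then $\overline S=\Gamma^{\boxdot}_S$; (2) $\Gamma\prec_S\Delta$ iff $\Gamma\prec_{\overline S}\Delta$. Moreover, assuming $\Gamma\prec_S\Delta$: (3) $\overline S$ is a $\Gamma$-full label; (4) $\overline S=\overline{\overline S}$; (5) $\overline S$ is the smallest $\mathbf{ILX}$-theory containing $S\cup\Gamma^{\boxdot}_S$.
   Context: Formulas: $\bot$, propositional variables, $\to$, $\Box$, binary $\rhd$; $\Diamond A:=\neg\Box\neg A$. $\mathbf{IL}$: classical tautologies, K, L: $\Box(\Box A\to A)\to\Box A$, J1: $\Box(A\to B)\to A\rhd B$, J2: $(A\rhd B)\wedge(B\rhd C)\to A\rhd C$, J3: $(A\rhd C)\wedge(B\rhd C)\to A\vee B\rhd C$, J4: $A\rhd B\to(\Diamond A\to\Diamond B)$, J5: $\Diamond A\rhd A$; rules modus ponens and necessitation. An $\mathbf{ILX}$-theory is a set containing $\mathbf{ILX}$ closed under modus ponens and necessitation; an $\mathbf{ILX}$-MCS is a maximal $\mathbf{ILX}$-consistent set. $\Gamma\prec_S\Delta$ iff for every formula $A$ and finite $S'\subseteq S$, $\neg A\rhd\bigvee_{\sigma\in S'}\neg\sigma\in\Gamma$ implies $A,\Box A\in\Delta$ (empty disjunction is $\bot$). $\Gamma^{\boxdot}_S=\{A,\Box A:\neg A\rhd\bigvee_{\sigma\in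 S'}\neg\sigma\in\Gamma$ for some finite $S'\subseteq S\}$. A set $T$ is a $\Gamma$-full label iff (i) $\neg A\rhd\bigvee_{\sigma\in T'}\neg\sigma\in\Gamma$ for some finite $T'\subseteq T$ implies $A,\Box A\in T$; (ii) $T$ is closed under $\mathbf{ILX}$-consequence; (iii) $B\in T$ implies $\Box B\in T$. The closure $\overline S$ (relative to $\Gamma$) is the intersection of all $\Gamma$-full labels containing $S$, i.e. the smallest $\Gamma$-full label containing $S$. -}

module Defs where

open import Level using (Level; _⊔_; 0ℓ) renaming (suc to lsuc)
open import Data.Nat using (ℕ)
open import Data.Bool using (Bool; true; false; not; _∨_)
open import Data.List using (List; []; _∷_)
open import Data.List.Relation.Unary.All using (All)
open import Data.Product using (Σ; _×_; _,_)
open import Data.Sum using (_⊎_)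
open import Relation.Binary.PropositionalEquality using (_≡_)
open import Relation.Nullary using (¬_)

infixr 6 _⇒_
infix 7 _▷_

data Fm : Set where
  ⊥'   : Fm
  var  : ℕ → Fm
  _⇒_  : Fm → Fm → Fm
  □    : Fm → Fm
  _▷_  : Fm → Fm → Fm

¬' : Fm → Fm
¬' A = A ⇒ ⊥'

⊤' : Fm
⊤' = ¬' ⊥'

_∨'_ : Fm → Fm → Fm
A ∨' B = ¬' A ⇒ B

_∧'_ : Fm → Fm → Fm
A ∧' B = ¬' (A ⇒ ¬' B)

◇ : Fm → Fm
◇ A = ¬' (□ (¬' A))

⋀ : List Fm → Fm
⋀ []      = ⊤'
⋀ (A ∷ l) = A ∧' ⋀ l

⋁¬ : List Fm → Fm
⋁¬ []      = ⊥'
⋁¬ (σ ∷ l) = ¬' σ ∨' ⋁¬ l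

-- Classical tautologies: true under every Boolean valuation treating
-- propositional variables, boxed formulas and ▷-formulas as atoms.

eval : (ℕ → Bool) → (Fm → Bool) → (Fm → Fm → Bool) → Fm → Bool
eval v b r ⊥'      = false
eval v b r (var n) = v n
eval v b r (A ⇒ B) = not (eval v b r A) ∨ eval v b r B
eval v b r (□ A)   = b A
eval v b r (A ▷ B) = r A B

Tautology : Fm → Set
Tautology A = ∀ v b r → eval v b r A ≡ true

FmSet : (ℓ : Level) → Set (lsuc ℓ)
FmSet ℓ = Fm → Set ℓ

_⊆_ : ∀ {a b} → FmSet a → FmSet b → Set (a ⊔ b)
S ⊆ T = ∀ A → S A → T A

_≐_ : ∀ {a b} → FmSet a → FmSet b → Set (a ⊔ b)
S ≐ T = (S ⊆ T) × (T ⊆ S)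

_∪_ : ∀ {a b} → FmSet a → FmSet b → FmSet (a ⊔ b)
(S ∪ T) A = S A ⊎ T A

-- The logic ILX = IL + extra axioms X (closed under MP and Nec)

data _⊢_ (X : FmSet 0ℓ) : Fm → Set where
  taut : ∀ {A} → Tautology A → X ⊢ A
  axK  : ∀ {A B} → X ⊢ (□ (A ⇒ B) ⇒ □ A ⇒ □ B)
  axL  : ∀ {A} → X ⊢ (□ (□ A ⇒ A) ⇒ □ A)
  axJ1 : ∀ {A B} → X ⊢ (□ (A ⇒ B) ⇒ A ▷ B)
  axJ2 : ∀ {A B C} → X ⊢ ((A ▷ B) ∧' (B ▷ C) ⇒ A ▷ C)
  axJ3 : ∀ {A B C} → X ⊢ ((A ▷ C) ∧' (B ▷ C) ⇒ (A ∨' B) ▷ C)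
  axJ4 : ∀ {A B} → X ⊢ (A ▷ B ⇒ (◇ A ⇒ ◇ B))
  axJ5 : ∀ {A} → X ⊢ (◇ A ▷ A)
  axX  : ∀ {A} → X A → X ⊢ A
  mp   : ∀ {A B} → X ⊢ (A ⇒ B) → X ⊢ A → X ⊢ B
  nec  : ∀ {A} → X ⊢ A → X ⊢ □ A

Theory : ∀ {ℓ} → FmSet 0ℓ → FmSet ℓ → Set ℓ
Theory X T =
  (∀ A → X ⊢ A → T A) ×
  (∀ A B → T (A ⇒ B) → T A → T B) ×
  (∀ A → T A → T (□ A))

Consistent : ∀ {ℓ} → FmSet 0ℓ → FmSet ℓ → Set ℓ
Consistent X Γ = ∀ (l : List Fm) → All Γ l → ¬ (X ⊢ (⋀ l ⇒ ⊥'))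

MCS : FmSet 0ℓ → FmSet 0ℓ → Set
MCS X Γ = Consistent X Γ × (∀ A → Consistent X (Γ ∪ (λ B → B ≡ A)) → Γ A)

Prec : ∀ {s} → FmSet 0ℓ → FmSet s → FmSet 0ℓ → Set s
Prec Γ S Δ = ∀ (A : Fm) (S' : List Fm) → All S S' →
  Γ (¬' A ▷ ⋁¬ S') → Δ A × Δ (□ A)

Boxdot : ∀ {s} → FmSet 0ℓ → FmSet s → FmSet s
Boxdot Γ S C = Σ Fm λ A → Σ (List Fm) λ S' →
  All S S' × Γ (¬' A ▷ ⋁¬ S') × (C ≡ A ⊎ C ≡ □ A)

ConseqClosed : ∀ {ℓ} → FmSet 0ℓ → FmSet ℓ → Set ℓ
ConseqClosed X T = ∀ (A : Fm) (l : List Fm) → All T l → X ⊢ (⋀ l ⇒ A) → T A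

FullLabel : ∀ {ℓ} → FmSet 0ℓ → FmSet 0ℓ → FmSet ℓ → Set ℓ
FullLabel X Γ T =
  (∀ (A : Fm) (T' : List Fm) → All T T' → Γ (¬' A ▷ ⋁¬ T') → T A × T (□ A)) ×
  ConseqClosed X T ×
  (∀ B → T B → T (□ B))

-- closure of S relative to Γ: intersection of all Γ-full labels containing S
-- (quantifying over labels at the universe level of S)
Closure : ∀ {s} → FmSet 0ℓ → FmSet 0ℓ → FmSet s → FmSet (lsuc s)
Closure {s} X Γ S A = (T : FmSet s) → FullLabel X Γ T → S ⊆ T → T A

module Submission where

-- Fix an ILX-MCS Γ and call a formula C *covered* by S when
-- ¬C ▷ ⋁_{σ∈S'} ¬σ ∈ Γ for some finite S' ⊆ S.  By J5 and J1, ¬□A ▷ ¬A ∈ Γ,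
-- so both A and □A are covered whenever A is; hence Γ^⊡_S consists exactly of
-- the covered formulas and their boxes.  Using J1–J3 inside Γ one shows that
-- if ¬A interprets the failure of finitely many covered formulas, then A is
-- covered.  From this, Γ^⊡_S is a Γ-full label containing S, and it is
-- contained in every Γ-full label containing S; so the closure of S equals
-- Γ^⊡_S (no assumption about Δ is needed).  All five claims follow: full
-- labels are theories, the closure of a full label is itself, and ≺_S only
-- depends on finitely many covered formulas.

open import Defs
open import Level using (Level; 0ℓ)
open import Data.Product using (_×_)
open import Function.Bundles using (_⇔_)

open import Data.Bool using (Bool; true; false; not; _∨_)
open import Data.Empty using (⊥-elim)
open import Data.List using (List; []; _∷_; _++_)
open import Data.List.Relation.Unary.All using (All; []; _∷_)
import Data.List.Relation.Unary.All as All
open import Data.List.Relation.Unary.All.Properties using (++⁺; ++⁻)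
open import Data.Nat using (ℕ)
open import Data.Product using (Σ; _,_; proj₁; proj₂; swap)
open import Data.Sum using (inj₁; inj₂; [_,_])
open import Function.Bundles using (mk⇔)
open import Function.Base using (_∘′_)
open import Relation.Binary.PropositionalEquality using (_≡_; refl)
open import Relation.Nullary using (¬_)

record Valuation : Set where
  constructor ⟨_,_,_⟩
  field
    atoms : ℕ → Bool
    boxes : Fm → Bool
    rels  : Fm → Fm → Bool

value : Valuation → Fm → Bool
value ⟨ v , b , r ⟩ = eval v b r

-- truth of a formula under a valuation (a record, so that the valuation
-- can be inferred from the type)
record _⊩_ (ρ : Valuation) (A : Fm) : Set where
  constructor holds
  field truth : value ρ A ≡ true

open _⊩_

not-∨-intro : ∀ a {b} → (a ≡ true → b ≡ true) → not a ∨ b ≡ true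
not-∨-intro true  f = f refl
not-∨-intro false f = refl

not-∨-elim : ∀ a {b} → not a ∨ b ≡ true → a ≡ true → b ≡ true
not-∨-elim true h refl = h

stable-true : ∀ a → ¬ ¬ (a ≡ true) → a ≡ true
stable-true true  nn = refl
stable-true false nn = ⊥-elim (nn (λ ()))

module _ {ρ : Valuation} where

  ⇒-intro : ∀ {A B} → (ρ ⊩ A → ρ ⊩ B) → ρ ⊩ (A ⇒ B)
  ⇒-intro {A} f = holds (not-∨-intro (value ρ A) (λ a → truth (f (holds a))))

  ⇒-elim : ∀ {A B} → ρ ⊩ (A ⇒ B) → ρ ⊩ A → ρ ⊩ B
  ⇒-elim {A} (holds h) (holds a) = holds (not-∨-elim (value ρ A) h a)

  by-cases : ∀ {A} → ¬ ¬ (ρ ⊩ A) → ρ ⊩ A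
  by-cases {A} nna = holds (stable-true (value ρ A) (λ na → nna (λ a → na (truth a))))

  ¬-intro : ∀ {A} → ¬ (ρ ⊩ A) → ρ ⊩ ¬' A
  ¬-intro na = ⇒-intro (λ a → ⊥-elim (na a))

  ¬-elim : ∀ {A} → ρ ⊩ ¬' A → ¬ (ρ ⊩ A)
  ¬-elim h a with ⇒-elim h a
  ... | holds ()

  ∧-intro : ∀ {A B} → ρ ⊩ A → ρ ⊩ B → ρ ⊩ (A ∧' B)
  ∧-intro a b = ¬-intro (λ h → ¬-elim (⇒-elim h a) b)

  ∧-elim : ∀ {A B} → ρ ⊩ (A ∧' B) → ρ ⊩ A × ρ ⊩ B
  ∧-elim h = by-cases (λ na → ¬-elim h (⇒-intro (λ a → ⊥-elim (na a))))
           , by-cases (λ nb → ¬-elim h (⇒-intro (λ _ → ¬-intro nb)))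

  ⋀-intro : ∀ {l} → All (ρ ⊩_) l → ρ ⊩ ⋀ l
  ⋀-intro []       = ¬-intro (λ { (holds ()) })
  ⋀-intro (a ∷ al) = ∧-intro a (⋀-intro al)

  ⋀-elim : ∀ l → ρ ⊩ ⋀ l → All (ρ ⊩_) l
  ⋀-elim []      _ = []
  ⋀-elim (A ∷ l) h with ∧-elim h
  ... | a , hl = a ∷ ⋀-elim l hl

  ⋁¬-intro : ∀ l → ¬ All (ρ ⊩_) l → ρ ⊩ ⋁¬ l
  ⋁¬-intro []      n = ⊥-elim (n [])
  ⋁¬-intro (σ ∷ l) n = ⇒-intro (λ nnσ →
    ⋁¬-intro l (λ al → n (by-cases (λ nσ → ¬-elim nnσ (¬-intro nσ)) ∷ al)))

  ⋁¬-elim : ∀ l → ρ ⊩ ⋁¬ l → ¬ All (ρ ⊩_) l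
  ⋁¬-elim []      (holds ()) _
  ⋁¬-elim (σ ∷ l) h (a ∷ al) = ⋁¬-elim l (⇒-elim h (¬-intro (λ nσ → ¬-elim nσ a))) al

_⊨_ : List Fm → Fm → Set
hs ⊨ A = ∀ ρ → All (ρ ⊩_) hs → ρ ⊩ A

_⇛_ : List Fm → Fm → Fm
[]       ⇛ A = A
(h ∷ hs) ⇛ A = h ⇒ (hs ⇛ A)

⇛-intro : ∀ {ρ} hs {A} → (All (ρ ⊩_) hs → ρ ⊩ A) → ρ ⊩ (hs ⇛ A)
⇛-intro []       f = f []
⇛-intro (h ∷ hs) f = ⇒-intro (λ a → ⇛-intro hs (λ al → f (a ∷ al)))

⊨-tautology : ∀ {hs A} → hs ⊨ A → Tautology (hs ⇛ A)
⊨-tautology {hs} e v b r = truth (⇛-intro hs (e ⟨ v , b , r ⟩))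

module _ {X : FmSet 0ℓ} where

  ⇛-mp : ∀ {hs A} → X ⊢ (hs ⇛ A) → All (X ⊢_) hs → X ⊢ A
  ⇛-mp d []       = d
  ⇛-mp d (e ∷ es) = ⇛-mp (mp d e) es

  ⊢-sem : ∀ {hs A} → All (X ⊢_) hs → hs ⊨ A → X ⊢ A
  ⊢-sem ds e = ⇛-mp (taut (⊨-tautology e)) ds

module Maximal {X Γ : FmSet 0ℓ} (mcs : MCS X Γ) where

  split : ∀ {A} l → All (Γ ∪ (λ B → B ≡ A)) l →
    Σ (List Fm) λ l' → All Γ l' × (∀ ρ → ρ ⊩ A → All (ρ ⊩_) l' → All (ρ ⊩_) l)
  split []      []             = [] , [] , λ _ _ _ → []
  split (B ∷ l) (inj₁ γB ∷ pl) with split l pl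
  ... | l' , γl' , imp = B ∷ l' , γB ∷ γl' , λ { ρ a (b ∷ hl') → b ∷ imp ρ a hl' }
  split (B ∷ l) (inj₂ refl ∷ pl) with split l pl
  ... | l' , γl' , imp = l' , γl' , λ ρ a hl' → a ∷ imp ρ a hl'

  -- if Γ ⊢ C then Γ ∪ {C} is consistent, so C ∈ Γ by maximality
  conseq-closed : ConseqClosed X Γ
  conseq-closed C l γl d = proj₂ mcs C consistent
    where
    consistent : Consistent X (Γ ∪ (λ B → B ≡ C))
    consistent l₂ p₂ d₂ with split l₂ p₂
    ... | l' , γl' , imp = proj₁ mcs (l ++ l') (++⁺ γl γl') (⊢-sem (d ∷ d₂ ∷ []) refute)
      where
      refute : ((⋀ l ⇒ C) ∷ (⋀ l₂ ⇒ ⊥') ∷ []) ⊨ (⋀ (l ++ l') ⇒ ⊥')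
      refute ρ (hd ∷ hd₂ ∷ []) = ⇒-intro λ h → case (++⁻ l (⋀-elim (l ++ l') h))
        where
        case : All (ρ ⊩_) l × All (ρ ⊩_) l' → ρ ⊩ ⊥'
        case (hl , hl') = ⇒-elim hd₂ (⋀-intro (imp ρ (⇒-elim hd (⋀-intro hl)) hl'))

  Γ-⊨ : ∀ {l A} → All Γ l → l ⊨ A → Γ A
  Γ-⊨ {l} {A} γl e =
    conseq-closed A l γl (⊢-sem [] (λ ρ _ → ⇒-intro (λ h → e ρ (⋀-elim l h))))

  Γ-thm : ∀ {A} → X ⊢ A → Γ A
  Γ-thm d = conseq-closed _ [] [] (⊢-sem (d ∷ []) (λ { ρ (a ∷ []) → ⇒-intro (λ _ → a) }))

module Interpretability {X Γ : FmSet 0ℓ} (mcs : MCS X Γ) where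
  open Maximal mcs public

  ▷-provable : ∀ {P Q} → X ⊢ (P ⇒ Q) → Γ (P ▷ Q)
  ▷-provable d = Γ-thm (mp axJ1 (nec d))

  ▷-tautology : ∀ {P Q} → (P ∷ []) ⊨ Q → Γ (P ▷ Q)
  ▷-tautology e = ▷-provable (⊢-sem [] (λ ρ _ → ⇒-intro (λ p → e ρ (p ∷ []))))

  ▷-trans : ∀ {P Q R} → Γ (P ▷ Q) → Γ (Q ▷ R) → Γ (P ▷ R)
  ▷-trans pq qr = Γ-⊨ (Γ-thm axJ2 ∷ pq ∷ qr ∷ [])
    (λ { ρ (j ∷ p ∷ q ∷ []) → ⇒-elim j (∧-intro p q) })

  ▷-join : ∀ {P Q R} → Γ (P ▷ R) → Γ (Q ▷ R) → Γ ((P ∨' Q) ▷ R)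
  ▷-join pr qr = Γ-⊨ (Γ-thm axJ3 ∷ pr ∷ qr ∷ [])
    (λ { ρ (j ∷ p ∷ q ∷ []) → ⇒-elim j (∧-intro p q) })

  -- ¬□A ▷ ¬A, from ¬□A → ◇¬A (K and necessitation) and J5: ◇¬A ▷ ¬A
  ¬□▷¬ : ∀ A → Γ (¬' (□ A) ▷ ¬' A)
  ¬□▷¬ A = ▷-trans (▷-provable ¬□⇒◇¬) (Γ-thm axJ5)
    where
    ¬¬-elim : X ⊢ (¬' (¬' A) ⇒ A)
    ¬¬-elim = ⊢-sem [] (λ ρ _ → ⇒-intro (λ nna → by-cases (λ na → ¬-elim nna (¬-intro na))))
    ¬□⇒◇¬ : X ⊢ (¬' (□ A) ⇒ ◇ (¬' A))
    ¬□⇒◇¬ = ⊢-sem (axK ∷ nec ¬¬-elim ∷ [])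
      (λ { ρ (k ∷ n ∷ []) → ⇒-intro (λ n□ → ¬-intro (λ b → ¬-elim n□ (⇒-elim (⇒-elim k n) b))) })

module Covering {X Γ : FmSet 0ℓ} (mcs : MCS X Γ) {s} (S : FmSet s) where
  open Interpretability mcs

  Covered : Fm → Set s
  Covered C = Σ (List Fm) λ S' → All S S' × Γ (¬' C ▷ ⋁¬ S')

  -- the failure of finitely many covered formulas interprets the failure of
  -- finitely many members of S (J3 for cons, J1 for weakening the disjunction)
  ⋁¬-covered : ∀ {l} → All Covered l → Σ (List Fm) λ S' → All S S' × Γ (⋁¬ l ▷ ⋁¬ S')
  ⋁¬-covered [] = [] , [] , ▷-tautology (λ { ρ (h ∷ []) → h })
  ⋁¬-covered ((Sσ , aσ , gσ) ∷ cl) with ⋁¬-covered cl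
  ... | Sl , al , gl = Sσ ++ Sl , ++⁺ aσ al ,
    ▷-join (▷-trans gσ (▷-tautology (weaken-left Sσ))) (▷-trans gl (▷-tautology (weaken-right Sσ)))
    where
    weaken-left : ∀ m {n} → (⋁¬ m ∷ []) ⊨ ⋁¬ (m ++ n)
    weaken-left m ρ (h ∷ []) = ⋁¬-intro (m ++ _) (λ a → ⋁¬-elim m h (proj₁ (++⁻ m a)))
    weaken-right : ∀ m {n} → (⋁¬ n ∷ []) ⊨ ⋁¬ (m ++ n)
    weaken-right m {n} ρ (h ∷ []) = ⋁¬-intro (m ++ n) (λ a → ⋁¬-elim n h (proj₂ (++⁻ m a)))

  covered-by : ∀ {A l} → All Covered l → Γ (¬' A ▷ ⋁¬ l) → Covered A
  covered-by cl g with ⋁¬-covered cl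
  ... | S' , aS' , h = S' , aS' , ▷-trans g h

  covered→boxdot : ∀ {C} → Covered C → Boxdot Γ S C
  covered→boxdot {C} (S' , a , g) = C , S' , a , g , inj₁ refl

  covered→boxdot□ : ∀ {C} → Covered C → Boxdot Γ S (□ C)
  covered→boxdot□ {C} (S' , a , g) = C , S' , a , g , inj₂ refl

  -- every member of Γ^⊡_S is covered: A is, and so is □A, by ¬□A ▷ ¬A
  boxdot→covered : ∀ {C} → Boxdot Γ S C → Covered C
  boxdot→covered (A , S' , a , g , inj₁ refl) = S' , a , g
  boxdot→covered (A , S' , a , g , inj₂ refl) = S' , a , ▷-trans (¬□▷¬ A) g

  boxdot-covered : ∀ {l} → All (Boxdot Γ S) l → All Covered l
  boxdot-covered = All.map boxdot→covered

  -- σ ∈ S is covered via S' = [σ]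
  S⊆boxdot : S ⊆ Boxdot Γ S
  S⊆boxdot σ sσ = covered→boxdot (σ ∷ [] , sσ ∷ [] ,
    ▷-tautology (λ { ρ (nσ ∷ []) → ⋁¬-intro (σ ∷ []) (λ { (a ∷ []) → ¬-elim nσ a }) }))

  boxdot-full : FullLabel X Γ (Boxdot Γ S)
  boxdot-full = full , conseq , λ B b → covered→boxdot□ (boxdot→covered b)
    where
    full : ∀ A T' → All (Boxdot Γ S) T' → Γ (¬' A ▷ ⋁¬ T') → Boxdot Γ S A × Boxdot Γ S (□ A)
    full A T' bT g = covered→boxdot c , covered→boxdot□ c
      where c = covered-by (boxdot-covered bT) g
    -- ⊢ ⋀ l → A gives ¬A ▷ ⋁¬ l by J1
    conseq : ConseqClosed X (Boxdot Γ S)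
    conseq A l bl d = covered→boxdot (covered-by (boxdot-covered bl) (▷-provable
      (⊢-sem (d ∷ []) (λ { ρ (h ∷ []) → ⇒-intro (λ na →
        ⋁¬-intro l (λ al → ¬-elim na (⇒-elim h (⋀-intro al)))) }))))

  -- clause (i) of a full label forces all of Γ^⊡_S into it
  boxdot-least : ∀ {t} {T : FmSet t} → FullLabel X Γ T → S ⊆ T → Boxdot Γ S ⊆ T
  boxdot-least (full , _ , _) S⊆T C (A , S' , a , g , eq)
    with full A S' (All.map (λ {x} → S⊆T x) a) g | eq
  ... | tA , _  | inj₁ refl = tA
  ... | _  , t□ | inj₂ refl = t□

prec-antitone : ∀ {Γ Δ : FmSet 0ℓ} {s t} {S : FmSet s} {T : FmSet t} →
  S ⊆ T → Prec Γ T Δ → Prec Γ S Δ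
prec-antitone S⊆T prec A S' aS = prec A S' (All.map (λ {x} → S⊆T x) aS)

module _ {X Γ : FmSet 0ℓ} where

  ⊆-closure : ∀ {s} {S : FmSet s} → S ⊆ Closure X Γ S
  ⊆-closure A sA T _ S⊆T = S⊆T A sA

  closure-least : ∀ {s} {S T : FmSet s} → FullLabel X Γ T → S ⊆ T → Closure X Γ S ⊆ T
  closure-least full S⊆T A c = c _ full S⊆T

  full-≐ : ∀ {a b} {T : FmSet a} {U : FmSet b} → FullLabel X Γ T → T ≐ U → FullLabel X Γ U
  full-≐ {T = T} {U} (full , conseq , boxed) (T⊆U , U⊆T) =
      (λ A T' aU g → let (tA , t□A) = full A T' (toT aU) g in T⊆U _ tA , T⊆U _ t□A)
    , (λ A l aU d → T⊆U A (conseq A l (toT aU) d))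
    , (λ B u → T⊆U _ (boxed B (U⊆T B u)))
    where
    toT : ∀ {l} → All U l → All T l
    toT = All.map (λ {x} → U⊆T x)

  -- full labels are ILX-theories: theorems and modus ponens are instances of
  -- consequence closure, necessitation is clause (iii)
  full⇒theory : ∀ {ℓ} {T : FmSet ℓ} → FullLabel X Γ T → Theory X T
  full⇒theory (_ , conseq , boxed) =
      (λ A d → conseq A [] [] (⊢-sem (d ∷ []) (λ { ρ (a ∷ []) → ⇒-intro (λ _ → a) })))
    , (λ A B ab a → conseq B _ (ab ∷ a ∷ [])
                     (⊢-sem [] (λ ρ _ → ⇒-intro (λ h → mp-in (⋀-elim (_ ∷ _ ∷ []) h)))))
    , boxed
    where
    mp-in : ∀ {ρ A B} → All (ρ ⊩_) ((A ⇒ B) ∷ A ∷ []) → ρ ⊩ B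
    mp-in (ab ∷ a ∷ []) = ⇒-elim ab a

  closure-of-full : ∀ {t} {T : FmSet t} → FullLabel X Γ T → Closure X Γ T ≐ T
  closure-of-full full = closure-least full (λ _ t → t) , ⊆-closure

  module _ (mcs : MCS X Γ) {s} {S : FmSet s} where
    open Covering mcs S

    -- Γ^⊡_S is the least Γ-full label containing S, hence equals the closure
    closure≐boxdot : Closure X Γ S ≐ Boxdot Γ S
    closure≐boxdot = closure-least boxdot-full S⊆boxdot
                   , λ C b T full S⊆T → boxdot-least full S⊆T C b

    closure-full : FullLabel X Γ (Closure X Γ S)
    closure-full = full-≐ boxdot-full (swap closure≐boxdot)

    prec-extend : ∀ {Δ t} {T : FmSet t} → T ⊆ Boxdot Γ S → Prec Γ S Δ → Prec Γ T Δ
    prec-extend T⊆B prec A T' aT g with covered-by (All.map (λ {x} → boxdot→covered ∘′ T⊆B x) aT) g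
    ... | S' , aS' , g' = prec A S' aS' g'

lemma4p13 : (ℓ : Level) (X Γ Δ S : FmSet 0ℓ) → MCS X Γ → MCS X Δ →
    (Prec Γ S Δ → Closure X Γ S ≐ Boxdot Γ S) ×
    (Prec Γ S Δ ⇔ Prec Γ (Closure X Γ S) Δ) ×
    (Prec Γ S Δ →
    FullLabel X Γ (Closure X Γ S) ×
    (Closure X Γ S ≐ Closure X Γ (Closure X Γ S)) ×
    (Theory X (Closure X Γ S) ×
    (S ∪ Boxdot Γ S) ⊆ Closure X Γ S ×
    ((T : FmSet ℓ) → Theory X T → (S ∪ Boxdot Γ S) ⊆ T → Closure X Γ S ⊆ T)))
-- (1) is closure≐boxdot; (2) holds since S ⊆ closure ⊆ Γ^⊡_S; (3)–(5) follow
-- from the closure being a full label equal to Γ^⊡_S.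
lemma4p13 ℓ X Γ Δ S mcsΓ _ =
    (λ _ → closure≐boxdot mcsΓ)
  , mk⇔ (prec-extend mcsΓ C⊆B) (prec-antitone {Γ = Γ} (⊆-closure {X} {Γ}))
  , λ _ → full
        , swap (closure-of-full {X} {Γ} full)
        , full⇒theory {X} {Γ} full
        , (λ A → [ ⊆-closure {X} {Γ} A , B⊆C A ])
        , λ T _ S∪B⊆T A c → S∪B⊆T A (inj₂ (C⊆B A c))
  where
  full : FullLabel X Γ (Closure X Γ S)
  full = closure-full mcsΓ
  C⊆B : Closure X Γ S ⊆ Boxdot Γ S
  C⊆B = proj₁ (closure≐boxdot mcsΓ)
  B⊆C : Boxdot Γ S ⊆ Closure X Γ S
  B⊆C = proj₂ (closure≐boxdot mcsΓ)
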